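{- Let $n,k$ be natural numbers with $n \ge k$, and let $c_{n,k}$ be the smallest positive integer such that for every $P \in E_n$ one has $c_{n,k} P^{(k)} \in E_n$. Then $$c_{n,k} = \mathrm{lcm}\{d_{m,k} \;;\; k \le m \le n\}.$$ In particular, $c_{n,k}$ divides $q_{n,k}$.
   Context: An integer-valued polynomial is a polynomial $P\in\mathbb{C}[X]$ with $P(\mathbb{Z})\subset\mathbb{Z}$; $E_n$ is the set of integer-valued polynomials of degree $\le n$, and $P^{(k)}$ is the $k$-th derivative. (A positive integer $c$ with $cP^{(k)}\in E_n$ for all $P\in E_n$ exists, e.g. $n!$, so $c_{n,k}$ is well defined.) For $n,k\in\mathbb{N}$ with $n\ge k$, define $$F_{n,k} = \sum_{\substack{i_1,\dots,i_k\in\mathbb{N}^*\\ i_1+\dots+i_k=n}} \frac{1}{i_1 i_2\cdots i_k},$$ with the conventions $F_{0,0}=1$ and $F_{n,0}=0$ for $n\ge1$; $d_{n,k}$ is the denominator of the rational number $F_{n,k}$, i.e. the smallest positive integer $d$ with $dF_{n,k}\in\mathbb{Z}$. Also define $$q_{n,k} = \mathrm{lcm}\{i_1 i_2\cdots i_k \mid i_1,\dots,i_k\in\mathbb{N}^*,\ i_1+\dots+i_k\le n\},$$ with the convention $q_{n,0}=1$. Here $\mathbb{N}^*$ is the set of positive integers. -}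

module Defs where

open import Data.Nat using (ℕ; zero; suc; _∸_; _≤_; _<_)
import Data.Nat as ℕ
open import Data.Nat.LCM using (lcm)
open import Data.Integer using (ℤ; +_)
open import Data.Rational using (ℚ; _/_; _+_; _*_; 0ℚ; ↧ₙ_)
open import Data.List using (List; []; _∷_; map; concatMap; upTo; foldr; length)
open import Data.Nat.ListAction using (product)
open import Data.Product using (Σ; ∃; _×_)
open import Relation.Binary.PropositionalEquality using (_≡_)

-- Polynomials with rational coefficients, as coefficient lists
-- [a₀, a₁, …] representing a₀ + a₁ X + a₂ X² + …

Poly : Set
Poly = List ℚ

ℤtoℚ : ℤ → ℚ
ℤtoℚ z = z / 1

ℕtoℚ : ℕ → ℚ
ℕtoℚ m = (+ m) / 1

eval : Poly → ℚ → ℚ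
eval []       x = 0ℚ
eval (a ∷ as) x = a + x * eval as x

DegLe : ℕ → Poly → Set
DegLe n P = length P ≤ suc n

IntegerValued : Poly → Set
IntegerValued P = (z : ℤ) → ∃ λ (m : ℤ) → eval P (ℤtoℚ z) ≡ ℤtoℚ m

E : ℕ → Poly → Set
E n P = DegLe n P × IntegerValued P

derivAux : ℕ → Poly → Poly
derivAux i []       = []
derivAux i (a ∷ as) = (ℕtoℚ i * a) ∷ derivAux (suc i) as

deriv : Poly → Poly
deriv []       = []
deriv (a ∷ as) = derivAux 1 as

derivN : ℕ → Poly → Poly
derivN zero    P = P
derivN (suc k) P = deriv (derivN k P)

scale : ℕ → Poly → Poly
scale c P = map (ℕtoℚ c *_) P

GoodMultiplier : ℕ → ℕ → ℕ → Set
GoodMultiplier n k c = 0 < c × ((P : Poly) → E n P → E n (scale c (derivN k P)))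

IsCnk : ℕ → ℕ → ℕ → Set
IsCnk n k c = GoodMultiplier n k c × ((c' : ℕ) → GoodMultiplier n k c' → c ≤ c')

comps : ℕ → ℕ → List (List ℕ)
comps zero    zero    = [] ∷ []
comps (suc n) zero    = []
comps n       (suc k) =
  concatMap (λ i → map (suc i ∷_) (comps (n ∸ suc i) k)) (upTo n)

-- 1/m for m > 0 (value at 0 irrelevant: only used on positive products)
recipℕ : ℕ → ℚ
recipℕ zero    = 0ℚ
recipℕ (suc m) = (+ 1) / suc m

sumℚ : List ℚ → ℚ
sumℚ = foldr _+_ 0ℚ

-- F_{n,k} = Σ_{i₁+…+i_k=n, iⱼ ≥ 1} 1/(i₁⋯i_k)   (F_{0,0}=1, F_{n,0}=0 for n ≥ 1)
F : ℕ → ℕ → ℚ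
F n k = sumℚ (map (λ is → recipℕ (product is)) (comps n k))

d : ℕ → ℕ → ℕ
d n k = ↧ₙ (F n k)

lcmList : List ℕ → ℕ
lcmList = foldr lcm 1

q : ℕ → ℕ → ℕ
q n k = lcmList (map product (concatMap (λ m → comps m k) (upTo (suc n))))

range : ℕ → ℕ → List ℕ
range k n = map (k ℕ.+_) (upTo (suc (n ∸ k)))

lcmD : ℕ → ℕ → ℕ
lcmD n k = lcmList (map (λ m → d m k) (range k n))

module Submission where

-- Over ℚ the derivative is the series log(1 + Δ) in the forward difference Δf(x) = f(x + 1) − f(x),
-- and (−1)^(m+k) F_{m,k} is the coefficient of tᵐ in log(1 + t)ᵏ; as Δ^(n+1) kills polynomials of
-- degree ≤ n, this gives P⁽ᵏ⁾ = ∑_{m ≤ n} (−1)^(m+k) F_{m,k} ΔᵐP, with F_{m,k} = 0 for m < k.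
-- The values ΔᵐP(x) of an integer-valued P are integers, so c P⁽ᵏ⁾ is integer-valued once every
-- d_{m,k} (k ≤ m ≤ n) divides c. Conversely the binomial polynomial (X choose m) lies in E_n and
-- Δʲ(X choose m)(0) = δ_{jm}, so c (X choose m)⁽ᵏ⁾(0) = ±c F_{m,k} must be an integer, i.e.
-- d_{m,k} ∣ c. Finally q_{n,k} F_{m,k} is a sum of the integers q_{n,k}/(i₁⋯i_k).

open import Defs
open import Data.Nat using (ℕ; _≤_)
open import Data.Nat.Divisibility using (_∣_)
open import Data.Product using (_×_)

open import Level using (0ℓ)
open import Function using (_∘_)
open import Data.Empty using (⊥-elim)
open import Data.Nat as ℕ using (zero; suc; _<_; z≤n; s≤s; _∸_; NonZero)
import Data.Nat.Properties as ℕP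
import Data.Nat.Tactic.RingSolver as ℕSolver
open import Data.Nat.Divisibility using (divides; ∣-trans; 1∣_; ∣⇒≤)
open import Data.Nat.Coprimality using (Coprime; coprime?; coprime-divisor)
import Data.Nat.Coprimality as Coprime
open import Data.Nat.LCM using (lcm; m∣lcm[m,n]; n∣lcm[m,n]; lcm-least; gcd*lcm)
open import Data.Nat.GCD using (gcd)
open import Data.Integer as ℤ using (ℤ; +_; -[1+_])
import Data.Integer.Properties as ℤP
import Data.Integer.Tactic.RingSolver as ℤSolver
open import Data.Rational using (ℚ; 0ℚ; 1ℚ; _+_; _*_; _-_; -_; toℚᵘ; mkℚ; ↥_; ↧_; ↧ₙ_)
import Data.Rational.Properties as ℚP
import Data.Rational.Unnormalised as ℚᵘ
import Data.Rational.Unnormalised.Properties as ℚᵘP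
open import Data.List using (List; []; _∷_; length; map; concatMap; upTo; applyUpTo; _++_)
import Data.List.Properties as ListP
open import Data.Nat.ListAction using (product)
open import Data.List.Membership.Propositional using (_∈_)
open import Data.List.Membership.Propositional.Properties
  using (∈-map⁺; ∈-map⁻; ∈-concat⁺′; ∈-upTo⁺; ∈-upTo⁻)
open import Data.List.Relation.Unary.Any using (here; there)
open import Data.Product using (Σ; _,_; proj₁; proj₂)
open import Relation.Nullary using (yes; no)
open import Relation.Nullary.Decidable using (recompute; dec⇒maybe)
open import Relation.Binary using (tri<; tri≈; tri>)
open import Relation.Binary.PropositionalEquality
open import Tactic.RingSolver using (solve-∀)
import Tactic.RingSolver.Core.AlmostCommutativeRing as ACR
open import Algebra.Properties.Group ℚP.+-0-group using (⁻¹-involutive)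

ℚ-ring : ACR.AlmostCommutativeRing 0ℓ 0ℓ
ℚ-ring = ACR.fromCommutativeRing ℚP.+-*-commutativeRing (λ x → dec⇒maybe (0ℚ ℚP.≟ x))

IsInteger : ℚ → Set
IsInteger p = Σ ℤ λ m → p ≡ ℤtoℚ m

toℚᵘ-ℤtoℚ : ∀ m → toℚᵘ (ℤtoℚ m) ℚᵘ.≃ ℚᵘ.mkℚᵘ m 0
toℚᵘ-ℤtoℚ m = ℚP.toℚᵘ-fromℚᵘ (ℚᵘ.mkℚᵘ m 0)

ℤtoℚ-homo-+ : ∀ a b → ℤtoℚ (a ℤ.+ b) ≡ ℤtoℚ a + ℤtoℚ b
ℤtoℚ-homo-+ a b = ℚP.toℚᵘ-injective (begin
  toℚᵘ (ℤtoℚ (a ℤ.+ b))            ≈⟨ toℚᵘ-ℤtoℚ (a ℤ.+ b) ⟩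
  ℚᵘ.mkℚᵘ (a ℤ.+ b) 0              ≈⟨ ℚᵘ.*≡* (cross a b) ⟩
  ℚᵘ.mkℚᵘ a 0 ℚᵘ.+ ℚᵘ.mkℚᵘ b 0     ≈⟨ ℚᵘP.+-cong (toℚᵘ-ℤtoℚ a) (toℚᵘ-ℤtoℚ b) ⟨
  toℚᵘ (ℤtoℚ a) ℚᵘ.+ toℚᵘ (ℤtoℚ b) ≈⟨ ℚP.toℚᵘ-homo-+ (ℤtoℚ a) (ℤtoℚ b) ⟨
  toℚᵘ (ℤtoℚ a + ℤtoℚ b)           ∎)
  where
  open ℚᵘP.≃-Reasoning
  cross : ∀ a b → (a ℤ.+ b) ℤ.* + 1 ≡ (a ℤ.* + 1 ℤ.+ b ℤ.* + 1) ℤ.* + 1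
  cross = ℤSolver.solve-∀

ℤtoℚ-homo-* : ∀ a b → ℤtoℚ (a ℤ.* b) ≡ ℤtoℚ a * ℤtoℚ b
ℤtoℚ-homo-* a b = ℚP.toℚᵘ-injective (begin
  toℚᵘ (ℤtoℚ (a ℤ.* b))            ≈⟨ toℚᵘ-ℤtoℚ (a ℤ.* b) ⟩
  ℚᵘ.mkℚᵘ (a ℤ.* b) 0              ≈⟨ ℚᵘ.*≡* refl ⟩
  ℚᵘ.mkℚᵘ a 0 ℚᵘ.* ℚᵘ.mkℚᵘ b 0     ≈⟨ ℚᵘP.*-cong (toℚᵘ-ℤtoℚ a) (toℚᵘ-ℤtoℚ b) ⟨
  toℚᵘ (ℤtoℚ a) ℚᵘ.* toℚᵘ (ℤtoℚ b) ≈⟨ ℚP.toℚᵘ-homo-* (ℤtoℚ a) (ℤtoℚ b) ⟨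
  toℚᵘ (ℤtoℚ a * ℤtoℚ b)           ∎)
  where open ℚᵘP.≃-Reasoning

ℤtoℚ-homo-neg : ∀ a → ℤtoℚ (ℤ.- a) ≡ - ℤtoℚ a
ℤtoℚ-homo-neg a = ℚP.toℚᵘ-injective (begin
  toℚᵘ (ℤtoℚ (ℤ.- a))  ≈⟨ toℚᵘ-ℤtoℚ (ℤ.- a) ⟩
  ℚᵘ.mkℚᵘ (ℤ.- a) 0    ≈⟨ ℚᵘP.-‿cong (toℚᵘ-ℤtoℚ a) ⟨
  ℚᵘ.- toℚᵘ (ℤtoℚ a)   ≈⟨ ℚP.toℚᵘ-homo‿- (ℤtoℚ a) ⟨
  toℚᵘ (- ℤtoℚ a)      ∎)
  where open ℚᵘP.≃-Reasoning

ℕtoℚ-homo-+ : ∀ a b → ℕtoℚ (a ℕ.+ b) ≡ ℕtoℚ a + ℕtoℚ b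
ℕtoℚ-homo-+ a b = trans (cong ℤtoℚ (ℤP.pos-+ a b)) (ℤtoℚ-homo-+ (+ a) (+ b))

ℕtoℚ-homo-* : ∀ a b → ℕtoℚ (a ℕ.* b) ≡ ℕtoℚ a * ℕtoℚ b
ℕtoℚ-homo-* a b = trans (cong ℤtoℚ (ℤP.pos-* a b)) (ℤtoℚ-homo-* (+ a) (+ b))

ℕtoℚ-suc : ∀ m → ℕtoℚ (suc m) ≡ ℕtoℚ m + 1ℚ
ℕtoℚ-suc m = trans (cong ℕtoℚ (ℕP.+-comm 1 m)) (ℕtoℚ-homo-+ m 1)

isInteger-0 : IsInteger 0ℚ
isInteger-0 = + 0 , refl

isInteger-1 : IsInteger 1ℚ
isInteger-1 = + 1 , refl

isInteger-+ : ∀ {r s} → IsInteger r → IsInteger s → IsInteger (r + s)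
isInteger-+ (a , refl) (b , refl) = a ℤ.+ b , sym (ℤtoℚ-homo-+ a b)

isInteger-* : ∀ {r s} → IsInteger r → IsInteger s → IsInteger (r * s)
isInteger-* (a , refl) (b , refl) = a ℤ.* b , sym (ℤtoℚ-homo-* a b)

isInteger-neg : ∀ {r} → IsInteger r → IsInteger (- r)
isInteger-neg (a , refl) = ℤ.- a , sym (ℤtoℚ-homo-neg a)

sign : ℕ → ℚ
sign zero    = 1ℚ
sign (suc i) = - sign i

sign-+ : ∀ i j → sign (i ℕ.+ j) ≡ sign i * sign j
sign-+ zero    j = sym (ℚP.*-identityˡ (sign j))
sign-+ (suc i) j = trans (cong -_ (sign-+ i j)) (ℚP.neg-distribˡ-* (sign i) (sign j))

sign-suc-suc : ∀ i → sign (suc (suc i)) ≡ sign i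
sign-suc-suc i = ⁻¹-involutive (sign i)

sign*sign : ∀ i → sign i * sign i ≡ 1ℚ
sign*sign zero    = refl
sign*sign (suc i) = trans (neg*neg (sign i)) (sign*sign i)
  where
  neg*neg : ∀ a → - a * - a ≡ a * a
  neg*neg = solve-∀ ℚ-ring

sign-isInteger : ∀ i → IsInteger (sign i)
sign-isInteger zero    = isInteger-1
sign-isInteger (suc i) = isInteger-neg (sign-isInteger i)

toℚᵘ-recipℕ : ∀ m → toℚᵘ (recipℕ (suc m)) ℚᵘ.≃ ℚᵘ.mkℚᵘ (+ 1) m
toℚᵘ-recipℕ m = ℚP.toℚᵘ-fromℚᵘ (ℚᵘ.mkℚᵘ (+ 1) m)

ℕtoℚ*recipℕ : ∀ m → ℕtoℚ (suc m) * recipℕ (suc m) ≡ 1ℚ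
ℕtoℚ*recipℕ m = ℚP.toℚᵘ-injective (begin
  toℚᵘ (ℕtoℚ (suc m) * recipℕ (suc m))
    ≈⟨ ℚP.toℚᵘ-homo-* (ℕtoℚ (suc m)) (recipℕ (suc m)) ⟩
  toℚᵘ (ℕtoℚ (suc m)) ℚᵘ.* toℚᵘ (recipℕ (suc m))
    ≈⟨ ℚᵘP.*-cong (toℚᵘ-ℤtoℚ (+ suc m)) (toℚᵘ-recipℕ m) ⟩
  ℚᵘ.mkℚᵘ (+ suc m) 0 ℚᵘ.* ℚᵘ.mkℚᵘ (+ 1) m
    ≈⟨ ℚᵘ.*≡* cross ⟩
  toℚᵘ 1ℚ ∎)
  where
  open ℚᵘP.≃-Reasoning
  cross : (+ suc m ℤ.* + 1) ℤ.* + 1 ≡ + 1 ℤ.* + (1 ℕ.* suc m)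
  cross = trans (ℤP.*-identityʳ _) (trans (ℤP.*-identityʳ _)
            (sym (trans (ℤP.*-identityˡ _) (cong +_ (ℕP.*-identityˡ (suc m))))))

recipℕ-homo-* : ∀ a b → recipℕ (a ℕ.* b) ≡ recipℕ a * recipℕ b
recipℕ-homo-* zero    b       = sym (ℚP.*-zeroˡ (recipℕ b))
recipℕ-homo-* (suc a) zero    rewrite ℕP.*-zeroʳ a = sym (ℚP.*-zeroʳ (recipℕ (suc a)))
recipℕ-homo-* (suc a) (suc b) = ℚP.toℚᵘ-injective (begin
  toℚᵘ (recipℕ (suc a ℕ.* suc b))
    ≈⟨ toℚᵘ-recipℕ (b ℕ.+ a ℕ.* suc b) ⟩
  ℚᵘ.mkℚᵘ (+ 1) (b ℕ.+ a ℕ.* suc b)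
    ≈⟨ ℚᵘ.*≡* refl ⟩
  ℚᵘ.mkℚᵘ (+ 1) a ℚᵘ.* ℚᵘ.mkℚᵘ (+ 1) b
    ≈⟨ ℚᵘP.*-cong (toℚᵘ-recipℕ a) (toℚᵘ-recipℕ b) ⟨
  toℚᵘ (recipℕ (suc a)) ℚᵘ.* toℚᵘ (recipℕ (suc b))
    ≈⟨ ℚP.toℚᵘ-homo-* (recipℕ (suc a)) (recipℕ (suc b)) ⟨
  toℚᵘ (recipℕ (suc a) * recipℕ (suc b)) ∎)
  where open ℚᵘP.≃-Reasoning

∣⇒isInteger-*recipℕ : ∀ {c m} → m ∣ c → IsInteger (ℕtoℚ c * recipℕ m)
∣⇒isInteger-*recipℕ {c} {zero}  _ = + 0 , ℚP.*-zeroʳ (ℕtoℚ c)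
∣⇒isInteger-*recipℕ {m = suc m} (divides t refl) = + t , (begin
  ℕtoℚ (t ℕ.* suc m) * recipℕ (suc m)          ≡⟨ cong (_* recipℕ (suc m)) (ℕtoℚ-homo-* t (suc m)) ⟩
  ℕtoℚ t * ℕtoℚ (suc m) * recipℕ (suc m)       ≡⟨ ℚP.*-assoc (ℕtoℚ t) (ℕtoℚ (suc m)) (recipℕ (suc m)) ⟩
  ℕtoℚ t * (ℕtoℚ (suc m) * recipℕ (suc m))     ≡⟨ cong (ℕtoℚ t *_) (ℕtoℚ*recipℕ m) ⟩
  ℕtoℚ t * 1ℚ                                  ≡⟨ ℚP.*-identityʳ (ℕtoℚ t) ⟩
  ℕtoℚ t                                       ∎)
  where open ≡-Reasoning

toℚᵘ-ℕtoℚ* : ∀ c p → toℚᵘ (ℕtoℚ c * p) ℚᵘ.≃ (+ c ℤ.* ↥ p) ℚᵘ./ ↧ₙ p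
toℚᵘ-ℕtoℚ* c p@(mkℚ n d _) = begin
  toℚᵘ (ℕtoℚ c * p)                   ≈⟨ ℚP.toℚᵘ-homo-* (ℕtoℚ c) p ⟩
  toℚᵘ (ℕtoℚ c) ℚᵘ.* ℚᵘ.mkℚᵘ n d      ≈⟨ ℚᵘP.*-congʳ (toℚᵘ-ℤtoℚ (+ c)) ⟩
  ℚᵘ.mkℚᵘ (+ c) 0 ℚᵘ.* ℚᵘ.mkℚᵘ n d    ≈⟨ ℚᵘ.*≡* (cong (λ e → + c ℤ.* n ℤ.* + e) (sym (ℕP.*-identityˡ (suc d)))) ⟩
  ℚᵘ.mkℚᵘ (+ c ℤ.* n) d               ∎
  where open ℚᵘP.≃-Reasoning

ℕtoℚ*≡ℤtoℚ⁺ : ∀ c p m → + c ℤ.* ↥ p ≡ m ℤ.* ↧ p → ℕtoℚ c * p ≡ ℤtoℚ m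
ℕtoℚ*≡ℤtoℚ⁺ c p m cross = ℚP.toℚᵘ-injective (begin
  toℚᵘ (ℕtoℚ c * p)              ≈⟨ toℚᵘ-ℕtoℚ* c p ⟩
  (+ c ℤ.* ↥ p) ℚᵘ./ ↧ₙ p        ≈⟨ ℚᵘ.*≡* (trans (ℤP.*-identityʳ (+ c ℤ.* ↥ p)) cross) ⟩
  ℚᵘ.mkℚᵘ m 0                    ≈⟨ toℚᵘ-ℤtoℚ m ⟨
  toℚᵘ (ℤtoℚ m)                  ∎)
  where open ℚᵘP.≃-Reasoning

ℕtoℚ*≡ℤtoℚ⁻ : ∀ c p m → ℕtoℚ c * p ≡ ℤtoℚ m → + c ℤ.* ↥ p ≡ m ℤ.* ↧ p
ℕtoℚ*≡ℤtoℚ⁻ c p m eq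
  with ℚᵘP.≃-trans (ℚᵘP.≃-sym (toℚᵘ-ℕtoℚ* c p)) (ℚᵘP.≃-trans (ℚP.toℚᵘ-cong eq) (toℚᵘ-ℤtoℚ m))
... | ℚᵘ.*≡* cross = trans (sym (ℤP.*-identityʳ (+ c ℤ.* ↥ p))) cross

↧ₙ∣⇒isInteger : ∀ c p → ↧ₙ p ∣ c → IsInteger (ℕtoℚ c * p)
↧ₙ∣⇒isInteger _ (mkℚ n d cop) (divides t refl) =
  + t ℤ.* n , ℕtoℚ*≡ℤtoℚ⁺ (t ℕ.* suc d) (mkℚ n d cop) (+ t ℤ.* n) (begin
    + (t ℕ.* suc d) ℤ.* n     ≡⟨ cong (ℤ._* n) (ℤP.pos-* t (suc d)) ⟩
    + t ℤ.* + suc d ℤ.* n     ≡⟨ swap (+ t) (+ suc d) n ⟩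
    + t ℤ.* n ℤ.* + suc d     ∎)
  where
  open ≡-Reasoning
  swap : ∀ a b c → a ℤ.* b ℤ.* c ≡ a ℤ.* c ℤ.* b
  swap = ℤSolver.solve-∀

isInteger⇒↧ₙ∣ : ∀ c p → IsInteger (ℕtoℚ c * p) → ↧ₙ p ∣ c
isInteger⇒↧ₙ∣ c (mkℚ n d cop) (m , eq) =
  coprime-divisor (Coprime.sym coprime) (divides ℤ.∣ m ∣ (begin
    ℤ.∣ n ∣ ℕ.* c            ≡⟨ ℕP.*-comm ℤ.∣ n ∣ c ⟩
    c ℕ.* ℤ.∣ n ∣            ≡⟨ ℤP.abs-* (+ c) n ⟨
    ℤ.∣ + c ℤ.* n ∣          ≡⟨ cong ℤ.∣_∣ (ℕtoℚ*≡ℤtoℚ⁻ c (mkℚ n d cop) m eq) ⟩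
    ℤ.∣ m ℤ.* + suc d ∣      ≡⟨ ℤP.abs-* m (+ suc d) ⟩
    ℤ.∣ m ∣ ℕ.* suc d        ∎))
  where
  open ≡-Reasoning
  coprime : Coprime ℤ.∣ n ∣ (suc d)
  coprime = recompute (coprime? ℤ.∣ n ∣ (suc d)) cop

∑ : ℕ → (ℕ → ℚ) → ℚ
∑ zero    f = 0ℚ
∑ (suc n) f = ∑ n f + f n

syntax ∑ n (λ i → e) = ∑[ i < n ] e

∑-cong : ∀ n {f g} → (∀ i → i < n → f i ≡ g i) → ∑ n f ≡ ∑ n g
∑-cong zero    f≡g = refl
∑-cong (suc n) f≡g = cong₂ _+_ (∑-cong n (λ i i<n → f≡g i (ℕP.m<n⇒m<1+n i<n))) (f≡g n ℕP.≤-refl)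

∑-zero : ∀ n f → (∀ i → i < n → f i ≡ 0ℚ) → ∑ n f ≡ 0ℚ
∑-zero zero    f f≡0 = refl
∑-zero (suc n) f f≡0 = cong₂ _+_ (∑-zero n f (λ i i<n → f≡0 i (ℕP.m<n⇒m<1+n i<n))) (f≡0 n ℕP.≤-refl)

∑-+ : ∀ n f g → ∑[ i < n ] (f i + g i) ≡ ∑ n f + ∑ n g
∑-+ zero    f g = refl
∑-+ (suc n) f g = trans (cong (_+ (f n + g n)) (∑-+ n f g)) (interchange (∑ n f) (∑ n g) (f n) (g n))
  where
  interchange : ∀ a b c d → (a + b) + (c + d) ≡ (a + c) + (b + d)
  interchange = solve-∀ ℚ-ring

*-distribˡ-∑ : ∀ n c f → c * ∑ n f ≡ ∑[ i < n ] (c * f i)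
*-distribˡ-∑ zero    c f = ℚP.*-zeroʳ c
*-distribˡ-∑ (suc n) c f =
  trans (ℚP.*-distribˡ-+ c (∑ n f) (f n)) (cong (_+ c * f n) (*-distribˡ-∑ n c f))

*-distribʳ-∑ : ∀ n c f → ∑ n f * c ≡ ∑[ i < n ] (f i * c)
*-distribʳ-∑ n c f = trans (ℚP.*-comm (∑ n f) c)
  (trans (*-distribˡ-∑ n c f) (∑-cong n (λ i _ → ℚP.*-comm c (f i))))

∑-suc : ∀ n f → ∑ (suc n) f ≡ f 0 + ∑[ i < n ] f (suc i)
∑-suc zero    f = trans (ℚP.+-identityˡ (f 0)) (sym (ℚP.+-identityʳ (f 0)))
∑-suc (suc n) f = trans (cong (_+ f (suc n)) (∑-suc n f))
  (ℚP.+-assoc (f 0) (∑[ i < n ] f (suc i)) (f (suc n)))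

∑-split : ∀ m n f → ∑ (m ℕ.+ n) f ≡ ∑ m f + ∑[ i < n ] f (m ℕ.+ i)
∑-split m zero    f rewrite ℕP.+-identityʳ m = sym (ℚP.+-identityʳ (∑ m f))
∑-split m (suc n) f rewrite ℕP.+-suc m n = trans (cong (_+ f (m ℕ.+ n)) (∑-split m n f))
  (ℚP.+-assoc (∑ m f) (∑[ i < n ] f (m ℕ.+ i)) (f (m ℕ.+ n)))

∑-single : ∀ n j f → j < n → (∀ i → i < n → i ≢ j → f i ≡ 0ℚ) → ∑ n f ≡ f j
∑-single (suc n) j f j<1+n others with j ℕP.≟ n
... | yes refl = trans (cong (_+ f j) (∑-zero n f (λ i i<n → others i (ℕP.m<n⇒m<1+n i<n) (ℕP.<⇒≢ i<n))))
                       (ℚP.+-identityˡ (f j))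
... | no  j≢n  = trans (cong₂ _+_ (∑-single n j f (ℕP.≤∧≢⇒< (ℕP.≤-pred j<1+n) j≢n)
                                     (λ i i<n → others i (ℕP.m<n⇒m<1+n i<n)))
                                  (others n ℕP.≤-refl (j≢n ∘ sym)))
                       (ℚP.+-identityʳ (f j))

∑-isInteger : ∀ n f → (∀ i → i < n → IsInteger (f i)) → IsInteger (∑ n f)
∑-isInteger zero    f int = isInteger-0
∑-isInteger (suc n) f int =
  isInteger-+ (∑-isInteger n f (λ i i<n → int i (ℕP.m<n⇒m<1+n i<n))) (int n ℕP.≤-refl)

-- Forward differences

Δ : (ℚ → ℚ) → ℚ → ℚ
Δ f x = f (x + 1ℚ) - f x

Δ^ : ℕ → (ℚ → ℚ) → ℚ → ℚ
Δ^ zero    f = f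
Δ^ (suc i) f = Δ (Δ^ i f)

Δ^-cong : ∀ i {f g} → (∀ y → f y ≡ g y) → ∀ x → Δ^ i f x ≡ Δ^ i g x
Δ^-cong zero    f≡g x = f≡g x
Δ^-cong (suc i) f≡g x = cong₂ _-_ (Δ^-cong i f≡g (x + 1ℚ)) (Δ^-cong i f≡g x)

Δ^-zero : ∀ i {f} → (∀ y → f y ≡ 0ℚ) → ∀ x → Δ^ i f x ≡ 0ℚ
Δ^-zero zero    f≡0 x = f≡0 x
Δ^-zero (suc i) f≡0 x = cong₂ _-_ (Δ^-zero i f≡0 (x + 1ℚ)) (Δ^-zero i f≡0 x)

Δ^-const : ∀ i a x → Δ^ (suc i) (λ _ → a) x ≡ 0ℚ
Δ^-const zero    a x = ℚP.+-inverseʳ a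
Δ^-const (suc i) a x = cong₂ _-_ (Δ^-const i a (x + 1ℚ)) (Δ^-const i a x)

Δ^-Δ^ : ∀ i j f x → Δ^ i (Δ^ j f) x ≡ Δ^ (i ℕ.+ j) f x
Δ^-Δ^ zero    j f x = refl
Δ^-Δ^ (suc i) j f x = cong₂ _-_ (Δ^-Δ^ i j f (x + 1ℚ)) (Δ^-Δ^ i j f x)

Δ^-+ : ∀ i f g x → Δ^ i (λ y → f y + g y) x ≡ Δ^ i f x + Δ^ i g x
Δ^-+ zero    f g x = refl
Δ^-+ (suc i) f g x = trans (cong₂ _-_ (Δ^-+ i f g (x + 1ℚ)) (Δ^-+ i f g x))
  (interchange (Δ^ i f (x + 1ℚ)) (Δ^ i g (x + 1ℚ)) (Δ^ i f x) (Δ^ i g x))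
  where
  interchange : ∀ a b c d → (a + b) - (c + d) ≡ (a - c) + (b - d)
  interchange = solve-∀ ℚ-ring

Δ^-* : ∀ i c f x → Δ^ i (λ y → c * f y) x ≡ c * Δ^ i f x
Δ^-* zero    c f x = refl
Δ^-* (suc i) c f x = trans (cong₂ _-_ (Δ^-* i c f (x + 1ℚ)) (Δ^-* i c f x))
  (sym (*-distribˡ-- c (Δ^ i f (x + 1ℚ)) (Δ^ i f x)))
  where
  *-distribˡ-- : ∀ c a b → c * (a - b) ≡ c * a - c * b
  *-distribˡ-- = solve-∀ ℚ-ring

Δ^-∑ : ∀ j n (h : ℕ → ℚ → ℚ) x → Δ^ j (λ y → ∑[ m < n ] h m y) x ≡ ∑[ m < n ] Δ^ j (h m) x
Δ^-∑ j zero    h x = Δ^-zero j (λ _ → refl) x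
Δ^-∑ j (suc n) h x = trans (Δ^-+ j (λ y → ∑[ m < n ] h m y) (h n) x) (cong (_+ Δ^ j (h n) x) (Δ^-∑ j n h x))

Δ^-x* : ∀ i f x → Δ^ (suc i) (λ y → y * f y) x ≡ x * Δ^ (suc i) f x + ℕtoℚ (suc i) * Δ^ i f (x + 1ℚ)
Δ^-x* zero    f x = rearrange x (f (x + 1ℚ)) (f x)
  where
  rearrange : ∀ x a b → (x + 1ℚ) * a - x * b ≡ x * (a - b) + 1ℚ * a
  rearrange = solve-∀ ℚ-ring
Δ^-x* (suc i) f x = begin
  Δ^ (suc i) (λ y → y * f y) (x + 1ℚ) - Δ^ (suc i) (λ y → y * f y) x
    ≡⟨ cong₂ _-_ (Δ^-x* i f (x + 1ℚ)) (Δ^-x* i f x) ⟩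
  ((x + 1ℚ) * (g (x + 1ℚ + 1ℚ) - g (x + 1ℚ)) + n * g (x + 1ℚ + 1ℚ)) - (x * (g (x + 1ℚ) - g x) + n * g (x + 1ℚ))
    ≡⟨ rearrange x n (g (x + 1ℚ + 1ℚ)) (g (x + 1ℚ)) (g x) ⟩
  x * ((g (x + 1ℚ + 1ℚ) - g (x + 1ℚ)) - (g (x + 1ℚ) - g x)) + (n + 1ℚ) * (g (x + 1ℚ + 1ℚ) - g (x + 1ℚ))
    ≡⟨ cong (λ t → x * Δ^ (suc (suc i)) f x + t * Δ^ (suc i) f (x + 1ℚ)) (ℕtoℚ-suc (suc i)) ⟨
  x * Δ^ (suc (suc i)) f x + ℕtoℚ (suc (suc i)) * Δ^ (suc i) f (x + 1ℚ) ∎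
  where
  open ≡-Reasoning
  g = Δ^ i f
  n = ℕtoℚ (suc i)
  rearrange : ∀ x n c b a → ((x + 1ℚ) * (c - b) + n * c) - (x * (b - a) + n * b) ≡
                            x * ((c - b) - (b - a)) + (n + 1ℚ) * (c - b)
  rearrange = solve-∀ ℚ-ring

∑-sign*Δ^-telescope : ∀ n g x → ∑[ i < n ] (sign i * Δ^ i g (x + 1ℚ)) ≡ g x - sign n * Δ^ n g x
∑-sign*Δ^-telescope zero    g x = rearrange (g x)
  where
  rearrange : ∀ a → 0ℚ ≡ a - 1ℚ * a
  rearrange = solve-∀ ℚ-ring
∑-sign*Δ^-telescope (suc n) g x =
  trans (cong (_+ sign n * Δ^ n g (x + 1ℚ)) (∑-sign*Δ^-telescope n g x))
        (rearrange (g x) (sign n) (Δ^ n g (x + 1ℚ)) (Δ^ n g x))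
  where
  rearrange : ∀ a s u v → (a - s * v) + s * u ≡ a - (- s) * (u - v)
  rearrange = solve-∀ ℚ-ring

Δ^-isInteger : ∀ j f → (∀ z → IsInteger (f (ℤtoℚ z))) → ∀ z → IsInteger (Δ^ j f (ℤtoℚ z))
Δ^-isInteger zero    f int z = int z
Δ^-isInteger (suc j) f int z = isInteger-+
  (subst (IsInteger ∘ Δ^ j f) (ℤtoℚ-homo-+ z (+ 1)) (Δ^-isInteger j f int (z ℤ.+ + 1)))
  (isInteger-neg (Δ^-isInteger j f int z))

length-derivAux : ∀ i P → length (derivAux i P) ≡ length P
length-derivAux i []      = refl
length-derivAux i (a ∷ P) = cong suc (length-derivAux (suc i) P)

length-derivN : ∀ k P → length (derivN k P) ≤ length P
length-derivN zero    P = ℕP.≤-refl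
length-derivN (suc k) P = ℕP.≤-trans (length-deriv (derivN k P)) (length-derivN k P)
  where
  length-deriv : ∀ P → length (deriv P) ≤ length P
  length-deriv []      = z≤n
  length-deriv (a ∷ P) = ℕP.≤-trans (ℕP.≤-reflexive (length-derivAux 1 P)) (ℕP.n≤1+n (length P))

eval-scale : ∀ c P x → eval (scale c P) x ≡ ℕtoℚ c * eval P x
eval-scale c []      x = sym (ℚP.*-zeroʳ (ℕtoℚ c))
eval-scale c (a ∷ P) x =
  trans (cong (λ v → ℕtoℚ c * a + x * v) (eval-scale c P x)) (rearrange (ℕtoℚ c) a x (eval P x))
  where
  rearrange : ∀ c a x v → c * a + x * (c * v) ≡ c * (a + x * v)
  rearrange = solve-∀ ℚ-ring

eval-derivAux-suc : ∀ i P x → eval (derivAux (suc i) P) x ≡ eval P x + eval (derivAux i P) x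
eval-derivAux-suc i []      x = refl
eval-derivAux-suc i (a ∷ P) x = begin
  ℕtoℚ (suc i) * a + x * eval (derivAux (suc (suc i)) P) x
    ≡⟨ cong₂ (λ u v → u * a + x * v) (ℕtoℚ-suc i) (eval-derivAux-suc (suc i) P x) ⟩
  (ℕtoℚ i + 1ℚ) * a + x * (eval P x + eval (derivAux (suc i) P) x)
    ≡⟨ rearrange (ℕtoℚ i) a x (eval P x) (eval (derivAux (suc i) P) x) ⟩
  (a + x * eval P x) + (ℕtoℚ i * a + x * eval (derivAux (suc i) P) x) ∎
  where
  open ≡-Reasoning
  rearrange : ∀ n a x e d → (n + 1ℚ) * a + x * (e + d) ≡ (a + x * e) + (n * a + x * d)
  rearrange = solve-∀ ℚ-ring

eval-deriv-∷ : ∀ a P x → eval (deriv (a ∷ P)) x ≡ eval P x + x * eval (deriv P) x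
eval-deriv-∷ a []      x = sym (trans (ℚP.+-identityˡ (x * 0ℚ)) (ℚP.*-zeroʳ x))
eval-deriv-∷ a (b ∷ P) x = trans (cong (λ v → 1ℚ * b + x * v) (eval-derivAux-suc 1 P x))
                                 (rearrange b x (eval P x) (eval (derivAux 1 P) x))
  where
  rearrange : ∀ b x e d → 1ℚ * b + x * (e + d) ≡ (b + x * e) + x * d
  rearrange = solve-∀ ℚ-ring

Δ^-eval-vanishes : ∀ P n → length P ≤ n → ∀ x → Δ^ n (eval P) x ≡ 0ℚ
Δ^-eval-vanishes []      n       _         x = Δ^-zero n (λ _ → refl) x
Δ^-eval-vanishes (a ∷ P) (suc n) (s≤s len) x = begin
  Δ^ (suc n) (λ y → a + y * eval P y) x
    ≡⟨ Δ^-+ (suc n) (λ _ → a) (λ y → y * eval P y) x ⟩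
  Δ^ (suc n) (λ _ → a) x + Δ^ (suc n) (λ y → y * eval P y) x
    ≡⟨ cong₂ _+_ (Δ^-const n a x) (Δ^-x* n (eval P) x) ⟩
  0ℚ + (x * (Δ^ n (eval P) (x + 1ℚ) - Δ^ n (eval P) x) + ℕtoℚ (suc n) * Δ^ n (eval P) (x + 1ℚ))
    ≡⟨ cong₂ (λ u v → 0ℚ + (x * (u - v) + ℕtoℚ (suc n) * u))
             (Δ^-eval-vanishes P n len (x + 1ℚ)) (Δ^-eval-vanishes P n len x) ⟩
  0ℚ + (x * (0ℚ - 0ℚ) + ℕtoℚ (suc n) * 0ℚ)
    ≡⟨ vanish x (ℕtoℚ (suc n)) ⟩
  0ℚ ∎
  where
  open ≡-Reasoning
  vanish : ∀ x n → 0ℚ + (x * (0ℚ - 0ℚ) + n * 0ℚ) ≡ 0ℚ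
  vanish = solve-∀ ℚ-ring

-- The derivative as a series in Δ

-- logCoeff i is the coefficient of tⁱ⁺¹ in log(1 + t).
logCoeff : ℕ → ℚ
logCoeff i = sign i * recipℕ (suc i)

logCoeff*Δ^-∷ : ∀ i a P x → logCoeff i * Δ^ (suc i) (eval (a ∷ P)) x ≡
                            x * (logCoeff i * Δ^ (suc i) (eval P) x) + sign i * Δ^ i (eval P) (x + 1ℚ)
logCoeff*Δ^-∷ i a P x = begin
  logCoeff i * Δ^ (suc i) (λ y → a + y * p y) x
    ≡⟨ cong (logCoeff i *_) (Δ^-+ (suc i) (λ _ → a) (λ y → y * p y) x) ⟩
  logCoeff i * (Δ^ (suc i) (λ _ → a) x + Δ^ (suc i) (λ y → y * p y) x)
    ≡⟨ cong₂ (λ u v → logCoeff i * (u + v)) (Δ^-const i a x) (Δ^-x* i p x) ⟩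
  logCoeff i * (0ℚ + (x * Δ^ (suc i) p x + ℕtoℚ (suc i) * Δ^ i p (x + 1ℚ)))
    ≡⟨ rearrange (sign i) (recipℕ (suc i)) (ℕtoℚ (suc i)) x (Δ^ (suc i) p x) (Δ^ i p (x + 1ℚ)) ⟩
  x * (logCoeff i * Δ^ (suc i) p x) + sign i * (ℕtoℚ (suc i) * recipℕ (suc i)) * Δ^ i p (x + 1ℚ)
    ≡⟨ cong (λ v → x * (logCoeff i * Δ^ (suc i) p x) + sign i * v * Δ^ i p (x + 1ℚ)) (ℕtoℚ*recipℕ i) ⟩
  x * (logCoeff i * Δ^ (suc i) p x) + sign i * 1ℚ * Δ^ i p (x + 1ℚ)
    ≡⟨ cong (λ v → x * (logCoeff i * Δ^ (suc i) p x) + v * Δ^ i p (x + 1ℚ)) (ℚP.*-identityʳ (sign i)) ⟩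
  x * (logCoeff i * Δ^ (suc i) p x) + sign i * Δ^ i p (x + 1ℚ) ∎
  where
  open ≡-Reasoning
  p = eval P
  rearrange : ∀ s r n x d e → s * r * (0ℚ + (x * d + n * e)) ≡ x * (s * r * d) + s * (n * r) * e
  rearrange = solve-∀ ℚ-ring

eval-deriv≡∑Δ : ∀ P n → length P ≤ n → ∀ x → eval (deriv P) x ≡ ∑[ i < n ] (logCoeff i * Δ^ (suc i) (eval P) x)
eval-deriv≡∑Δ [] n _ x =
  sym (∑-zero n _ (λ i _ → trans (cong (logCoeff i *_) (Δ^-const i 0ℚ x)) (ℚP.*-zeroʳ (logCoeff i))))
eval-deriv≡∑Δ (a ∷ P) (suc n) (s≤s len) x = begin
  eval (deriv (a ∷ P)) x
    ≡⟨ eval-deriv-∷ a P x ⟩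
  p x + x * eval (deriv P) x
    ≡⟨ cong (λ v → p x + x * v) (eval-deriv≡∑Δ P (suc n) len′ x) ⟩
  p x + x * S
    ≡⟨ rearrange (p x) (x * S) (sign (suc n)) ⟩
  x * S + (p x - sign (suc n) * 0ℚ)
    ≡⟨ cong (λ v → x * S + (p x - sign (suc n) * v)) (Δ^-eval-vanishes P (suc n) len′ x) ⟨
  x * S + (p x - sign (suc n) * Δ^ (suc n) p x)
    ≡⟨ cong₂ _+_ (*-distribˡ-∑ (suc n) x _) (sym (∑-sign*Δ^-telescope (suc n) p x)) ⟩
  ∑[ i < suc n ] (x * (logCoeff i * Δ^ (suc i) p x)) + ∑[ i < suc n ] (sign i * Δ^ i p (x + 1ℚ))
    ≡⟨ ∑-+ (suc n) _ _ ⟨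
  ∑[ i < suc n ] (x * (logCoeff i * Δ^ (suc i) p x) + sign i * Δ^ i p (x + 1ℚ))
    ≡⟨ ∑-cong (suc n) (λ i _ → logCoeff*Δ^-∷ i a P x) ⟨
  ∑[ i < suc n ] (logCoeff i * Δ^ (suc i) (eval (a ∷ P)) x) ∎
  where
  open ≡-Reasoning
  p = eval P
  len′ = ℕP.m≤n⇒m≤1+n len
  S = ∑[ i < suc n ] (logCoeff i * Δ^ (suc i) p x)
  rearrange : ∀ a b s → a + b ≡ b + (a - s * 0ℚ)
  rearrange = solve-∀ ℚ-ring

sumℚ-++ : ∀ xs ys → sumℚ (xs ++ ys) ≡ sumℚ xs + sumℚ ys
sumℚ-++ []       ys = sym (ℚP.+-identityˡ (sumℚ ys))
sumℚ-++ (x ∷ xs) ys = trans (cong (_+_ x) (sumℚ-++ xs ys)) (sym (ℚP.+-assoc x (sumℚ xs) (sumℚ ys)))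

sumℚ-concatMap : ∀ {A B : Set} (f : B → ℚ) (g : A → List B) xs →
                 sumℚ (map f (concatMap g xs)) ≡ sumℚ (map (λ a → sumℚ (map f (g a))) xs)
sumℚ-concatMap f g []       = refl
sumℚ-concatMap f g (a ∷ xs) = begin
  sumℚ (map f (g a ++ concatMap g xs))               ≡⟨ cong sumℚ (ListP.map-++ f (g a) (concatMap g xs)) ⟩
  sumℚ (map f (g a) ++ map f (concatMap g xs))       ≡⟨ sumℚ-++ (map f (g a)) (map f (concatMap g xs)) ⟩
  sumℚ (map f (g a)) + sumℚ (map f (concatMap g xs)) ≡⟨ cong (_+_ (sumℚ (map f (g a)))) (sumℚ-concatMap f g xs) ⟩
  sumℚ (map f (g a)) + sumℚ (map (λ a → sumℚ (map f (g a))) xs) ∎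
  where open ≡-Reasoning

sumℚ-map-applyUpTo : ∀ (h : ℕ → ℚ) g n → sumℚ (map h (applyUpTo g n)) ≡ ∑[ i < n ] h (g i)
sumℚ-map-applyUpTo h g zero    = refl
sumℚ-map-applyUpTo h g (suc n) =
  trans (cong (_+_ (h (g 0))) (sumℚ-map-applyUpTo h (g ∘ suc) n)) (sym (∑-suc n (h ∘ g)))

sumℚ-recipℕ-product-∷ : ∀ i Ls → sumℚ (map (recipℕ ∘ product) (map (suc i ∷_) Ls)) ≡
                                 recipℕ (suc i) * sumℚ (map (recipℕ ∘ product) Ls)
sumℚ-recipℕ-product-∷ i []       = sym (ℚP.*-zeroʳ (recipℕ (suc i)))
sumℚ-recipℕ-product-∷ i (is ∷ Ls) = begin
  recipℕ (suc i ℕ.* product is) + sumℚ (map (recipℕ ∘ product) (map (suc i ∷_) Ls))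
    ≡⟨ cong₂ _+_ (recipℕ-homo-* (suc i) (product is)) (sumℚ-recipℕ-product-∷ i Ls) ⟩
  recipℕ (suc i) * recipℕ (product is) + recipℕ (suc i) * sumℚ (map (recipℕ ∘ product) Ls)
    ≡⟨ ℚP.*-distribˡ-+ (recipℕ (suc i)) (recipℕ (product is)) _ ⟨
  recipℕ (suc i) * (recipℕ (product is) + sumℚ (map (recipℕ ∘ product) Ls)) ∎
  where open ≡-Reasoning

comps-suc : ∀ t k → comps t (suc k) ≡ concatMap (λ i → map (suc i ∷_) (comps (t ∸ suc i) k)) (upTo t)
comps-suc zero    k = refl
comps-suc (suc t) k = refl

F-suc : ∀ t k → F t (suc k) ≡ ∑[ i < t ] (recipℕ (suc i) * F (t ∸ suc i) k)
F-suc t k = begin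
  sumℚ (map (recipℕ ∘ product) (comps t (suc k)))
    ≡⟨ cong (sumℚ ∘ map (recipℕ ∘ product)) (comps-suc t k) ⟩
  sumℚ (map (recipℕ ∘ product) (concatMap first (upTo t)))
    ≡⟨ sumℚ-concatMap (recipℕ ∘ product) first (upTo t) ⟩
  sumℚ (map (λ i → sumℚ (map (recipℕ ∘ product) (first i))) (upTo t))
    ≡⟨ sumℚ-map-applyUpTo (λ i → sumℚ (map (recipℕ ∘ product) (first i))) (λ i → i) t ⟩
  ∑[ i < t ] sumℚ (map (recipℕ ∘ product) (first i))
    ≡⟨ ∑-cong t (λ i _ → sumℚ-recipℕ-product-∷ i (comps (t ∸ suc i) k)) ⟩
  ∑[ i < t ] (recipℕ (suc i) * F (t ∸ suc i) k) ∎
  where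
  open ≡-Reasoning
  first : ℕ → List (List ℕ)
  first i = map (suc i ∷_) (comps (t ∸ suc i) k)

F-below : ∀ m k → m < k → F m k ≡ 0ℚ
F-below m (suc k) (s≤s m≤k) = trans (F-suc m k) (∑-zero m _ λ i i<m →
  trans (cong (recipℕ (suc i) *_) (F-below (m ∸ suc i) k (ℕP.<-≤-trans (∸-suc-< i<m) m≤k)))
        (ℚP.*-zeroʳ (recipℕ (suc i))))
  where
  ∸-suc-< : ∀ {i m} → i < m → m ∸ suc i < m
  ∸-suc-< {i} {suc m} _ = s≤s (ℕP.m∸n≤m m i)

-- G m k is the coefficient of tᵐ in log(1 + t)ᵏ.
G : ℕ → ℕ → ℚ
G m k = sign (m ℕ.+ k) * F m k

G-suc : ∀ t k → G t (suc k) ≡ ∑[ i < t ] (logCoeff i * G (t ∸ suc i) k)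
G-suc t k = begin
  sign (t ℕ.+ suc k) * F t (suc k)
    ≡⟨ cong (sign (t ℕ.+ suc k) *_) (F-suc t k) ⟩
  sign (t ℕ.+ suc k) * ∑[ i < t ] (recipℕ (suc i) * F (t ∸ suc i) k)
    ≡⟨ *-distribˡ-∑ t (sign (t ℕ.+ suc k)) _ ⟩
  ∑[ i < t ] (sign (t ℕ.+ suc k) * (recipℕ (suc i) * F (t ∸ suc i) k))
    ≡⟨ ∑-cong t term ⟨
  ∑[ i < t ] (logCoeff i * G (t ∸ suc i) k) ∎
  where
  open ≡-Reasoning
  sign-split : ∀ {i} → i < t → sign i * sign (t ∸ suc i ℕ.+ k) ≡ sign (t ℕ.+ suc k)
  sign-split {i} i<t = begin
    sign i * sign (t ∸ suc i ℕ.+ k)                  ≡⟨ sign-+ i (t ∸ suc i ℕ.+ k) ⟨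
    sign (i ℕ.+ (t ∸ suc i ℕ.+ k))                   ≡⟨ sign-suc-suc (i ℕ.+ (t ∸ suc i ℕ.+ k)) ⟨
    sign (suc (suc (i ℕ.+ (t ∸ suc i ℕ.+ k))))       ≡⟨ cong sign (reassoc i (t ∸ suc i) k) ⟩
    sign (suc i ℕ.+ (t ∸ suc i) ℕ.+ suc k)           ≡⟨ cong (λ n → sign (n ℕ.+ suc k)) (ℕP.m+[n∸m]≡n i<t) ⟩
    sign (t ℕ.+ suc k)                               ∎
    where
    reassoc : ∀ i d k → suc (suc (i ℕ.+ (d ℕ.+ k))) ≡ suc i ℕ.+ d ℕ.+ suc k
    reassoc = ℕSolver.solve-∀
  rearrange : ∀ s r s′ f → s * r * (s′ * f) ≡ (s * s′) * (r * f)
  rearrange = solve-∀ ℚ-ring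
  term : ∀ i → i < t → logCoeff i * G (t ∸ suc i) k ≡ sign (t ℕ.+ suc k) * (recipℕ (suc i) * F (t ∸ suc i) k)
  term i i<t = trans (rearrange (sign i) (recipℕ (suc i)) (sign (t ∸ suc i ℕ.+ k)) (F (t ∸ suc i) k))
                     (cong (_* (recipℕ (suc i) * F (t ∸ suc i) k)) (sign-split i<t))

module _ (a b h : ℕ → ℚ) where

  rowSum : ℕ → ℕ → ℚ
  rowSum n i = ∑[ m < n ∸ suc i ] (b m * h (suc (i ℕ.+ m)))

  ∑-triangle : ∀ n → ∑[ t < n ] ∑[ i < t ] (a i * (b (t ∸ suc i) * h t)) ≡ ∑[ i < n ] (a i * rowSum n i)
  ∑-triangle zero    = refl
  ∑-triangle (suc n) = begin
    ∑[ t < n ] ∑[ i < t ] (a i * (b (t ∸ suc i) * h t)) + ∑[ i < n ] (a i * (b (n ∸ suc i) * h n))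
      ≡⟨ cong (_+ ∑[ i < n ] (a i * (b (n ∸ suc i) * h n))) (∑-triangle n) ⟩
    ∑[ i < n ] (a i * rowSum n i) + ∑[ i < n ] (a i * (b (n ∸ suc i) * h n))
      ≡⟨ ∑-+ n _ _ ⟨
    ∑[ i < n ] (a i * rowSum n i + a i * (b (n ∸ suc i) * h n))
      ≡⟨ ∑-cong n extend ⟩
    ∑[ i < n ] (a i * rowSum (suc n) i)
      ≡⟨ ℚP.+-identityʳ _ ⟨
    ∑[ i < n ] (a i * rowSum (suc n) i) + 0ℚ
      ≡⟨ cong (_+_ (∑[ i < n ] (a i * rowSum (suc n) i))) lastRow ⟨
    ∑[ i < n ] (a i * rowSum (suc n) i) + a n * rowSum (suc n) n ∎
    where
    open ≡-Reasoning
    lastRow : a n * rowSum (suc n) n ≡ 0ℚ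
    lastRow = trans (cong (λ l → a n * ∑[ m < l ] (b m * h (suc (n ℕ.+ m)))) (ℕP.n∸n≡0 n)) (ℚP.*-zeroʳ (a n))
    extend : ∀ i → i < n → a i * rowSum n i + a i * (b (n ∸ suc i) * h n) ≡ a i * rowSum (suc n) i
    extend i i<n = begin
      a i * rowSum n i + a i * (b (n ∸ suc i) * h n)
        ≡⟨ ℚP.*-distribˡ-+ (a i) (rowSum n i) _ ⟨
      a i * (rowSum n i + b (n ∸ suc i) * h n)
        ≡⟨ cong (λ l → a i * (rowSum n i + b (n ∸ suc i) * h l)) (ℕP.m+[n∸m]≡n i<n) ⟨
      a i * ∑[ m < suc (n ∸ suc i) ] (b m * h (suc (i ℕ.+ m)))
        ≡⟨ cong (λ l → a i * ∑[ m < l ] (b m * h (suc (i ℕ.+ m)))) (ℕP.+-∸-assoc 1 i<n) ⟨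
      a i * rowSum (suc n) i ∎

  ∑-truncate : ∀ n → (∀ s → n ≤ s → h s ≡ 0ℚ) → ∀ i → i < n →
               ∑[ m < n ] (b m * h (suc (i ℕ.+ m))) ≡ rowSum n i
  ∑-truncate n h≡0 i i<n = begin
    ∑ n f                                   ≡⟨ cong (λ l → ∑ l f) (ℕP.m∸n+n≡m i<n) ⟨
    ∑ (n ∸ suc i ℕ.+ suc i) f               ≡⟨ ∑-split (n ∸ suc i) (suc i) f ⟩
    ∑ (n ∸ suc i) f + ∑[ j < suc i ] f (n ∸ suc i ℕ.+ j)
                                            ≡⟨ cong (_+_ (∑ (n ∸ suc i) f)) (∑-zero (suc i) _ beyond) ⟩
    ∑ (n ∸ suc i) f + 0ℚ                    ≡⟨ ℚP.+-identityʳ _ ⟩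
    ∑ (n ∸ suc i) f                         ∎
    where
    open ≡-Reasoning
    f = λ m → b m * h (suc (i ℕ.+ m))
    beyond : ∀ j → j < suc i → f (n ∸ suc i ℕ.+ j) ≡ 0ℚ
    beyond j _ = trans (cong (b (n ∸ suc i ℕ.+ j) *_) (h≡0 _ n≤)) (ℚP.*-zeroʳ (b (n ∸ suc i ℕ.+ j)))
      where
      reassoc : ∀ p i j → p ℕ.+ suc i ℕ.+ j ≡ suc (i ℕ.+ (p ℕ.+ j))
      reassoc = ℕSolver.solve-∀
      n≤ : n ≤ suc (i ℕ.+ (n ∸ suc i ℕ.+ j))
      n≤ = ℕP.≤-trans (ℕP.≤-reflexive (sym (ℕP.m∸n+n≡m i<n)))
             (ℕP.≤-trans (ℕP.m≤m+n (n ∸ suc i ℕ.+ suc i) j) (ℕP.≤-reflexive (reassoc (n ∸ suc i) i j)))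

  -- Composing the series ∑ aᵢ tⁱ⁺¹ and ∑ bₘ tᵐ gives tᵗ the coefficient ∑_{i<t} aᵢ b_{t−1−i};
  -- as h vanishes from n on, every sum may stop at n.
  ∑-convolution : ∀ n → (∀ s → n ≤ s → h s ≡ 0ℚ) →
    ∑[ i < n ] (a i * ∑[ m < n ] (b m * h (suc (i ℕ.+ m)))) ≡ ∑[ t < n ] (∑[ i < t ] (a i * b (t ∸ suc i)) * h t)
  ∑-convolution n h≡0 = begin
    ∑[ i < n ] (a i * ∑[ m < n ] (b m * h (suc (i ℕ.+ m))))
      ≡⟨ ∑-cong n (λ i i<n → cong (a i *_) (∑-truncate n h≡0 i i<n)) ⟩
    ∑[ i < n ] (a i * rowSum n i)
      ≡⟨ ∑-triangle n ⟨
    ∑[ t < n ] ∑[ i < t ] (a i * (b (t ∸ suc i) * h t))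
      ≡⟨ ∑-cong n (λ t _ → trans (∑-cong t (λ i _ → sym (ℚP.*-assoc (a i) (b (t ∸ suc i)) (h t))))
                                (sym (*-distribʳ-∑ t (h t) (λ i → a i * b (t ∸ suc i))))) ⟩
    ∑[ t < n ] (∑[ i < t ] (a i * b (t ∸ suc i)) * h t) ∎
    where open ≡-Reasoning

eval-derivN≡∑Δ : ∀ k P n → length P ≤ n → ∀ x → eval (derivN k P) x ≡ ∑[ m < n ] (G m k * Δ^ m (eval P) x)
eval-derivN≡∑Δ zero    [] zero    _   x = refl
eval-derivN≡∑Δ zero    P  (suc n) _   x = begin
  eval P x
    ≡⟨ rearrange (eval P x) ⟩
  1ℚ * eval P x + 0ℚ
    ≡⟨ cong (_+_ (1ℚ * eval P x)) (∑-zero n _ (λ m _ → higher m)) ⟨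
  G 0 0 * eval P x + ∑[ m < n ] (G (suc m) 0 * Δ^ (suc m) (eval P) x)
    ≡⟨ ∑-suc n (λ m → G m 0 * Δ^ m (eval P) x) ⟨
  ∑[ m < suc n ] (G m 0 * Δ^ m (eval P) x) ∎
  where
  open ≡-Reasoning
  rearrange : ∀ v → v ≡ 1ℚ * v + 0ℚ
  rearrange = solve-∀ ℚ-ring
  higher : ∀ m → G (suc m) 0 * Δ^ (suc m) (eval P) x ≡ 0ℚ
  higher m = trans (cong (_* Δ^ (suc m) (eval P) x) (ℚP.*-zeroʳ (sign (suc m ℕ.+ 0))))
                   (ℚP.*-zeroˡ (Δ^ (suc m) (eval P) x))
eval-derivN≡∑Δ (suc k) P  n       len x = begin
  eval (deriv (derivN k P)) x
    ≡⟨ eval-deriv≡∑Δ (derivN k P) n (ℕP.≤-trans (length-derivN k P) len) x ⟩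
  ∑[ i < n ] (logCoeff i * Δ^ (suc i) (eval (derivN k P)) x)
    ≡⟨ ∑-cong n (λ i _ → cong (logCoeff i *_) (Δ^-derivN i)) ⟩
  ∑[ i < n ] (logCoeff i * ∑[ m < n ] (G m k * Δ^ (suc i ℕ.+ m) p x))
    ≡⟨ ∑-convolution logCoeff (λ m → G m k) (λ s → Δ^ s p x) n
                     (λ s n≤s → Δ^-eval-vanishes P s (ℕP.≤-trans len n≤s) x) ⟩
  ∑[ t < n ] (∑[ i < t ] (logCoeff i * G (t ∸ suc i) k) * Δ^ t p x)
    ≡⟨ ∑-cong n (λ t _ → cong (_* Δ^ t p x) (G-suc t k)) ⟨
  ∑[ m < n ] (G m (suc k) * Δ^ m p x) ∎
  where
  open ≡-Reasoning
  p = eval P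
  Δ^-derivN : ∀ i → Δ^ (suc i) (eval (derivN k P)) x ≡ ∑[ m < n ] (G m k * Δ^ (suc i ℕ.+ m) p x)
  Δ^-derivN i = begin
    Δ^ (suc i) (eval (derivN k P)) x
      ≡⟨ Δ^-cong (suc i) (eval-derivN≡∑Δ k P n len) x ⟩
    Δ^ (suc i) (λ y → ∑[ m < n ] (G m k * Δ^ m p y)) x
      ≡⟨ Δ^-∑ (suc i) n (λ m y → G m k * Δ^ m p y) x ⟩
    ∑[ m < n ] Δ^ (suc i) (λ y → G m k * Δ^ m p y) x
      ≡⟨ ∑-cong n (λ m _ → trans (Δ^-* (suc i) (G m k) (Δ^ m p) x) (cong (G m k *_) (Δ^-Δ^ (suc i) m p x))) ⟩
    ∑[ m < n ] (G m k * Δ^ (suc i ℕ.+ m) p x) ∎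

-- Sufficiency of the denominators

*F-isInteger : ∀ n k c → (∀ m → k ≤ m → m ≤ n → d m k ∣ c) → ∀ m → m ≤ n → IsInteger (ℕtoℚ c * F m k)
*F-isInteger n k c d∣c m m≤n with k ℕP.≤? m
... | yes k≤m = ↧ₙ∣⇒isInteger c (F m k) (d∣c m k≤m m≤n)
... | no  k≰m = + 0 , trans (cong (ℕtoℚ c *_) (F-below m k (ℕP.≰⇒> k≰m))) (ℚP.*-zeroʳ (ℕtoℚ c))

scale-derivN-∈E : ∀ n k c → (∀ m → k ≤ m → m ≤ n → d m k ∣ c) → ∀ P → E n P → E n (scale c (derivN k P))
scale-derivN-∈E n k c d∣c P (deg , int) = degree , values
  where
  degree : DegLe n (scale c (derivN k P))
  degree = ℕP.≤-trans (ℕP.≤-reflexive (ListP.length-map (ℕtoℚ c *_) (derivN k P)))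
                      (ℕP.≤-trans (length-derivN k P) deg)
  term : ∀ z m → m < suc n → IsInteger (ℕtoℚ c * (G m k * Δ^ m (eval P) (ℤtoℚ z)))
  term z m (s≤s m≤n) = subst IsInteger (rearrange (ℕtoℚ c) (sign (m ℕ.+ k)) (F m k) (Δ^ m (eval P) (ℤtoℚ z)))
    (isInteger-* (isInteger-* (sign-isInteger (m ℕ.+ k)) (*F-isInteger n k c d∣c m m≤n))
                 (Δ^-isInteger m (eval P) int z))
    where
    rearrange : ∀ c s f v → s * (c * f) * v ≡ c * (s * f * v)
    rearrange = solve-∀ ℚ-ring
  values : IntegerValued (scale c (derivN k P))
  values z = subst IsInteger (sym (begin
    eval (scale c (derivN k P)) x                    ≡⟨ eval-scale c (derivN k P) x ⟩
    ℕtoℚ c * eval (derivN k P) x                     ≡⟨ cong (ℕtoℚ c *_) (eval-derivN≡∑Δ k P (suc n) deg x) ⟩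
    ℕtoℚ c * ∑[ m < suc n ] (G m k * Δ^ m (eval P) x) ≡⟨ *-distribˡ-∑ (suc n) (ℕtoℚ c) _ ⟩
    ∑[ m < suc n ] (ℕtoℚ c * (G m k * Δ^ m (eval P) x)) ∎))
    (∑-isInteger (suc n) _ (term z))
    where
    open ≡-Reasoning
    x = ℤtoℚ z

-- Binomial polynomials

infixl 6 _+ₚ_
infixl 7 _*ₚ_

_+ₚ_ : Poly → Poly → Poly
[]      +ₚ Q       = Q
(a ∷ P) +ₚ []      = a ∷ P
(a ∷ P) +ₚ (b ∷ Q) = (a + b) ∷ (P +ₚ Q)

_*ₚ_ : ℚ → Poly → Poly
r *ₚ P = map (r *_) P

eval-+ₚ : ∀ P Q x → eval (P +ₚ Q) x ≡ eval P x + eval Q x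
eval-+ₚ []      Q       x = sym (ℚP.+-identityˡ (eval Q x))
eval-+ₚ (a ∷ P) []      x = sym (ℚP.+-identityʳ (a + x * eval P x))
eval-+ₚ (a ∷ P) (b ∷ Q) x =
  trans (cong (λ v → (a + b) + x * v) (eval-+ₚ P Q x)) (rearrange a b x (eval P x) (eval Q x))
  where
  rearrange : ∀ a b x u v → (a + b) + x * (u + v) ≡ (a + x * u) + (b + x * v)
  rearrange = solve-∀ ℚ-ring

eval-*ₚ : ∀ r P x → eval (r *ₚ P) x ≡ r * eval P x
eval-*ₚ r []      x = sym (ℚP.*-zeroʳ r)
eval-*ₚ r (a ∷ P) x = trans (cong (λ v → r * a + x * v) (eval-*ₚ r P x)) (rearrange r a x (eval P x))
  where
  rearrange : ∀ r a x v → r * a + x * (r * v) ≡ r * (a + x * v)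
  rearrange = solve-∀ ℚ-ring

length-+ₚ : ∀ P Q n → length P ≤ n → length Q ≤ n → length (P +ₚ Q) ≤ n
length-+ₚ []      Q       n       _         lenQ      = lenQ
length-+ₚ (a ∷ P) []      n       lenP      _         = lenP
length-+ₚ (a ∷ P) (b ∷ Q) (suc n) (s≤s lenP) (s≤s lenQ) = s≤s (length-+ₚ P Q n lenP lenQ)

binom : ℕ → ℚ → ℚ
binom zero    x = 1ℚ
binom (suc m) x = recipℕ (suc m) * ((x - ℕtoℚ m) * binom m x)

binomialPoly : ℕ → Poly
binomialPoly zero    = 1ℚ ∷ []
binomialPoly (suc m) = recipℕ (suc m) *ₚ ((0ℚ ∷ binomialPoly m) +ₚ (- ℕtoℚ m) *ₚ binomialPoly m)

length-binomialPoly : ∀ m → length (binomialPoly m) ≤ suc m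
length-binomialPoly zero    = ℕP.≤-refl
length-binomialPoly (suc m) = begin
  length (binomialPoly (suc m))         ≡⟨ ListP.length-map _ ((0ℚ ∷ B) +ₚ (- ℕtoℚ m) *ₚ B) ⟩
  length ((0ℚ ∷ B) +ₚ (- ℕtoℚ m) *ₚ B)  ≤⟨ length-+ₚ (0ℚ ∷ B) ((- ℕtoℚ m) *ₚ B) (suc (suc m)) (s≤s len) lenScaled ⟩
  suc (suc m)                           ∎
  where
  open ℕP.≤-Reasoning
  B = binomialPoly m
  len = length-binomialPoly m
  lenScaled : length ((- ℕtoℚ m) *ₚ B) ≤ suc (suc m)
  lenScaled = ℕP.≤-trans (ℕP.≤-reflexive (ListP.length-map _ B)) (ℕP.m≤n⇒m≤1+n len)

eval-binomialPoly : ∀ m x → eval (binomialPoly m) x ≡ binom m x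
eval-binomialPoly zero    x = trans (cong (_+_ 1ℚ) (ℚP.*-zeroʳ x)) (ℚP.+-identityʳ 1ℚ)
eval-binomialPoly (suc m) x = begin
  eval (recipℕ (suc m) *ₚ ((0ℚ ∷ B) +ₚ (- ℕtoℚ m) *ₚ B)) x
    ≡⟨ eval-*ₚ (recipℕ (suc m)) ((0ℚ ∷ B) +ₚ (- ℕtoℚ m) *ₚ B) x ⟩
  recipℕ (suc m) * eval ((0ℚ ∷ B) +ₚ (- ℕtoℚ m) *ₚ B) x
    ≡⟨ cong (recipℕ (suc m) *_) (eval-+ₚ (0ℚ ∷ B) ((- ℕtoℚ m) *ₚ B) x) ⟩
  recipℕ (suc m) * ((0ℚ + x * eval B x) + eval ((- ℕtoℚ m) *ₚ B) x)
    ≡⟨ cong (λ v → recipℕ (suc m) * ((0ℚ + x * eval B x) + v)) (eval-*ₚ (- ℕtoℚ m) B x) ⟩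
  recipℕ (suc m) * ((0ℚ + x * eval B x) + (- ℕtoℚ m) * eval B x)
    ≡⟨ rearrange (recipℕ (suc m)) x (ℕtoℚ m) (eval B x) ⟩
  recipℕ (suc m) * ((x - ℕtoℚ m) * eval B x)
    ≡⟨ cong (λ v → recipℕ (suc m) * ((x - ℕtoℚ m) * v)) (eval-binomialPoly m x) ⟩
  binom (suc m) x ∎
  where
  open ≡-Reasoning
  B = binomialPoly m
  rearrange : ∀ r x n u → r * ((0ℚ + x * u) + (- n) * u) ≡ r * ((x - n) * u)
  rearrange = solve-∀ ℚ-ring

ℕtoℚ*binom-suc : ∀ m x → ℕtoℚ (suc m) * binom (suc m) x ≡ (x - ℕtoℚ m) * binom m x
ℕtoℚ*binom-suc m x = begin
  ℕtoℚ (suc m) * (recipℕ (suc m) * v)   ≡⟨ ℚP.*-assoc (ℕtoℚ (suc m)) (recipℕ (suc m)) v ⟨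
  ℕtoℚ (suc m) * recipℕ (suc m) * v     ≡⟨ cong (_* v) (ℕtoℚ*recipℕ m) ⟩
  1ℚ * v                                ≡⟨ ℚP.*-identityˡ v ⟩
  v                                     ∎
  where
  open ≡-Reasoning
  v = (x - ℕtoℚ m) * binom m x

Δ-binom : ∀ m x → Δ (binom (suc m)) x ≡ binom m x
Δ-binom zero    x = rearrange x
  where
  rearrange : ∀ x → 1ℚ * ((x + 1ℚ - 0ℚ) * 1ℚ) - 1ℚ * ((x - 0ℚ) * 1ℚ) ≡ 1ℚ
  rearrange = solve-∀ ℚ-ring
Δ-binom (suc m) x = begin
  r * ((x + 1ℚ - M) * binom (suc m) (x + 1ℚ)) - r * ((x - M) * w)
    ≡⟨ cong (λ v → r * ((x + 1ℚ - M) * v) - r * ((x - M) * w)) pascal ⟩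
  r * ((x + 1ℚ - M) * (w + u)) - r * ((x - M) * w)
    ≡⟨ expand r x M w u ⟩
  r * (w + (x + 1ℚ - M) * u)
    ≡⟨ cong (λ v → r * (w + v)) key ⟩
  r * (w + M * w)
    ≡⟨ collect r M w ⟩
  (M + 1ℚ) * r * w
    ≡⟨ cong (λ t → t * r * w) (ℕtoℚ-suc (suc m)) ⟨
  ℕtoℚ (suc (suc m)) * r * w
    ≡⟨ cong (_* w) (ℕtoℚ*recipℕ (suc m)) ⟩
  1ℚ * w
    ≡⟨ ℚP.*-identityˡ w ⟩
  w ∎
  where
  open ≡-Reasoning
  r = recipℕ (suc (suc m))
  M = ℕtoℚ (suc m)
  w = binom (suc m) x
  u = binom m x
  expand : ∀ r x M w u → r * ((x + 1ℚ - M) * (w + u)) - r * ((x - M) * w) ≡ r * (w + (x + 1ℚ - M) * u)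
  expand = solve-∀ ℚ-ring
  collect : ∀ r M w → r * (w + M * w) ≡ (M + 1ℚ) * r * w
  collect = solve-∀ ℚ-ring
  cancel : ∀ x m → x + 1ℚ - (m + 1ℚ) ≡ x - m
  cancel = solve-∀ ℚ-ring
  add-back : ∀ a b → b + (a - b) ≡ a
  add-back = solve-∀ ℚ-ring
  pascal : binom (suc m) (x + 1ℚ) ≡ w + u
  pascal = trans (sym (add-back (binom (suc m) (x + 1ℚ)) w)) (cong (_+_ w) (Δ-binom m x))
  key : (x + 1ℚ - M) * u ≡ M * w
  key = begin
    (x + 1ℚ - M) * u               ≡⟨ cong (λ t → (x + 1ℚ - t) * u) (ℕtoℚ-suc m) ⟩
    (x + 1ℚ - (ℕtoℚ m + 1ℚ)) * u   ≡⟨ cong (_* u) (cancel x (ℕtoℚ m)) ⟩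
    (x - ℕtoℚ m) * u               ≡⟨ ℕtoℚ*binom-suc m x ⟨
    M * w                          ∎

binom-suc-0 : ∀ m → binom (suc m) 0ℚ ≡ 0ℚ
binom-suc-0 zero    = refl
binom-suc-0 (suc m) = trans (cong (λ v → recipℕ (suc (suc m)) * ((0ℚ - ℕtoℚ (suc m)) * v)) (binom-suc-0 m))
                            (vanish (recipℕ (suc (suc m))) (ℕtoℚ (suc m)))
  where
  vanish : ∀ r M → r * ((0ℚ - M) * 0ℚ) ≡ 0ℚ
  vanish = solve-∀ ℚ-ring

isInteger-from-Δ : ∀ g → IsInteger (g 0ℚ) → (∀ z → IsInteger (Δ g (ℤtoℚ z))) → ∀ z → IsInteger (g (ℤtoℚ z))
isInteger-from-Δ g g0 Δg = at
  where
  up : ∀ y → IsInteger (g y) → IsInteger (Δ g y) → IsInteger (g (y + 1ℚ))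
  up y gy Δgy = subst IsInteger (add-back (g (y + 1ℚ)) (g y)) (isInteger-+ gy Δgy)
    where
    add-back : ∀ a b → b + (a - b) ≡ a
    add-back = solve-∀ ℚ-ring
  down : ∀ y → IsInteger (g (y + 1ℚ)) → IsInteger (Δ g y) → IsInteger (g y)
  down y gy+1 Δgy = subst IsInteger (take-back (g (y + 1ℚ)) (g y)) (isInteger-+ gy+1 (isInteger-neg Δgy))
    where
    take-back : ∀ a b → a - (a - b) ≡ b
    take-back = solve-∀ ℚ-ring
  at : ∀ z → IsInteger (g (ℤtoℚ z))
  at-pred : ∀ n → IsInteger (g (ℤtoℚ (-[1+ n ] ℤ.+ + 1)))
  at (+ zero)    = g0
  at (+ suc n)   = subst (IsInteger ∘ g) (sym (ℕtoℚ-suc n)) (up (ℕtoℚ n) (at (+ n)) (Δg (+ n)))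
  at -[1+ n ]    = down (ℤtoℚ -[1+ n ])
                        (subst (IsInteger ∘ g) (ℤtoℚ-homo-+ -[1+ n ] (+ 1)) (at-pred n)) (Δg -[1+ n ])
  at-pred zero    = g0
  at-pred (suc n) = at -[1+ n ]

binom-isInteger : ∀ m z → IsInteger (binom m (ℤtoℚ z))
binom-isInteger zero    z = isInteger-1
binom-isInteger (suc m) = isInteger-from-Δ (binom (suc m)) (subst IsInteger (sym (binom-suc-0 m)) isInteger-0)
  (λ z → subst IsInteger (sym (Δ-binom m (ℤtoℚ z))) (binom-isInteger m z))

Δ^-binom : ∀ j r x → Δ^ j (binom (j ℕ.+ r)) x ≡ binom r x
Δ^-binom zero    r x = refl
Δ^-binom (suc j) r x = begin
  Δ^ (suc j) (binom (suc j ℕ.+ r)) x       ≡⟨ cong (λ i → Δ^ i (binom (suc j ℕ.+ r)) x) (ℕP.+-comm 1 j) ⟩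
  Δ^ (j ℕ.+ 1) (binom (suc j ℕ.+ r)) x     ≡⟨ Δ^-Δ^ j 1 (binom (suc j ℕ.+ r)) x ⟨
  Δ^ j (Δ (binom (suc (j ℕ.+ r)))) x       ≡⟨ Δ^-cong j (Δ-binom (j ℕ.+ r)) x ⟩
  Δ^ j (binom (j ℕ.+ r)) x                 ≡⟨ Δ^-binom j r x ⟩
  binom r x                                ∎
  where open ≡-Reasoning

Δ^-binomialPoly-0-diag : ∀ m → Δ^ m (eval (binomialPoly m)) 0ℚ ≡ 1ℚ
Δ^-binomialPoly-0-diag m = begin
  Δ^ m (eval (binomialPoly m)) 0ℚ  ≡⟨ Δ^-cong m (eval-binomialPoly m) 0ℚ ⟩
  Δ^ m (binom m) 0ℚ                ≡⟨ cong (λ i → Δ^ m (binom i) 0ℚ) (ℕP.+-identityʳ m) ⟨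
  Δ^ m (binom (m ℕ.+ 0)) 0ℚ        ≡⟨ Δ^-binom m 0 0ℚ ⟩
  1ℚ                               ∎
  where open ≡-Reasoning

Δ^-binomialPoly-0-off : ∀ m j → j ≢ m → Δ^ j (eval (binomialPoly m)) 0ℚ ≡ 0ℚ
Δ^-binomialPoly-0-off m j j≢m with ℕP.<-cmp j m
... | tri≈ _ j≡m _ = ⊥-elim (j≢m j≡m)
... | tri> _ _ m<j = Δ^-eval-vanishes (binomialPoly m) j (ℕP.≤-trans (length-binomialPoly m) m<j) 0ℚ
... | tri< j<m _ _ = begin
  Δ^ j (eval (binomialPoly m)) 0ℚ          ≡⟨ Δ^-cong j (eval-binomialPoly m) 0ℚ ⟩
  Δ^ j (binom m) 0ℚ                        ≡⟨ cong (λ i → Δ^ j (binom i) 0ℚ) m≡ ⟩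
  Δ^ j (binom (j ℕ.+ suc (m ∸ suc j))) 0ℚ  ≡⟨ Δ^-binom j (suc (m ∸ suc j)) 0ℚ ⟩
  binom (suc (m ∸ suc j)) 0ℚ               ≡⟨ binom-suc-0 (m ∸ suc j) ⟩
  0ℚ                                       ∎
  where
  open ≡-Reasoning
  m≡ : m ≡ j ℕ.+ suc (m ∸ suc j)
  m≡ = sym (trans (ℕP.+-suc j (m ∸ suc j)) (ℕP.m+[n∸m]≡n j<m))

-- Necessity of the denominators

good⇒d∣ : ∀ n k c → GoodMultiplier n k c → ∀ m → m ≤ n → d m k ∣ c
good⇒d∣ n k c (_ , good) m m≤n =
  isInteger⇒↧ₙ∣ c (F m k) (subst IsInteger unsign (isInteger-* (sign-isInteger (m ℕ.+ k)) c*G))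
  where
  B = binomialPoly m
  len = ℕP.≤-trans (length-binomialPoly m) (s≤s m≤n)
  B∈E : E n B
  B∈E = len , λ z → subst IsInteger (sym (eval-binomialPoly m (ℤtoℚ z))) (binom-isInteger m z)
  value : eval (scale c (derivN k B)) 0ℚ ≡ ℕtoℚ c * G m k
  value = begin
    eval (scale c (derivN k B)) 0ℚ
      ≡⟨ eval-scale c (derivN k B) 0ℚ ⟩
    ℕtoℚ c * eval (derivN k B) 0ℚ
      ≡⟨ cong (ℕtoℚ c *_) (eval-derivN≡∑Δ k B (suc n) len 0ℚ) ⟩
    ℕtoℚ c * ∑[ j < suc n ] (G j k * Δ^ j (eval B) 0ℚ)
      ≡⟨ cong (ℕtoℚ c *_) (∑-single (suc n) m _ (s≤s m≤n) off) ⟩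
    ℕtoℚ c * (G m k * Δ^ m (eval B) 0ℚ)
      ≡⟨ cong (λ v → ℕtoℚ c * (G m k * v)) (Δ^-binomialPoly-0-diag m) ⟩
    ℕtoℚ c * (G m k * 1ℚ)
      ≡⟨ cong (ℕtoℚ c *_) (ℚP.*-identityʳ (G m k)) ⟩
    ℕtoℚ c * G m k ∎
    where
    open ≡-Reasoning
    off : ∀ j → j < suc n → j ≢ m → G j k * Δ^ j (eval B) 0ℚ ≡ 0ℚ
    off j _ j≢m = trans (cong (G j k *_) (Δ^-binomialPoly-0-off m j j≢m)) (ℚP.*-zeroʳ (G j k))
  c*G : IsInteger (ℕtoℚ c * G m k)
  c*G = subst IsInteger value (proj₂ (good B B∈E) (+ 0))
  unsign : sign (m ℕ.+ k) * (ℕtoℚ c * G m k) ≡ ℕtoℚ c * F m k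
  unsign = begin
    sign (m ℕ.+ k) * (ℕtoℚ c * (sign (m ℕ.+ k) * F m k))  ≡⟨ rearrange (ℕtoℚ c) (sign (m ℕ.+ k)) (F m k) ⟩
    sign (m ℕ.+ k) * sign (m ℕ.+ k) * (ℕtoℚ c * F m k)   ≡⟨ cong (_* (ℕtoℚ c * F m k)) (sign*sign (m ℕ.+ k)) ⟩
    1ℚ * (ℕtoℚ c * F m k)                                ≡⟨ ℚP.*-identityˡ (ℕtoℚ c * F m k) ⟩
    ℕtoℚ c * F m k                                       ∎
    where
    open ≡-Reasoning
    rearrange : ∀ c s f → s * (c * (s * f)) ≡ s * s * (c * f)
    rearrange = solve-∀ ℚ-ring

lcm-pos : ∀ {a b} → 0 < a → 0 < b → 0 < lcm a b
lcm-pos {a} {b} 0<a 0<b = ℕ.>-nonZero⁻¹ (lcm a b) {{ℕP.m*n≢0⇒n≢0 (gcd a b) {{gcd*lcm≢0}}}}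
  where
  gcd*lcm≢0 : NonZero (gcd a b ℕ.* lcm a b)
  gcd*lcm≢0 = subst NonZero (sym (gcd*lcm a b)) (ℕP.m*n≢0 a b {{ℕ.>-nonZero 0<a}} {{ℕ.>-nonZero 0<b}})

∈⇒∣lcmList : ∀ {x xs} → x ∈ xs → x ∣ lcmList xs
∈⇒∣lcmList {xs = y ∷ xs} (here refl) = m∣lcm[m,n] y (lcmList xs)
∈⇒∣lcmList {xs = y ∷ xs} (there x∈xs) = ∣-trans (∈⇒∣lcmList x∈xs) (n∣lcm[m,n] y (lcmList xs))

lcmList-least : ∀ xs {c} → (∀ {x} → x ∈ xs → x ∣ c) → lcmList xs ∣ c
lcmList-least []       _   = 1∣ _
lcmList-least (x ∷ xs) all∣ = lcm-least (all∣ (here refl)) (lcmList-least xs (all∣ ∘ there))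

lcmList-pos : ∀ xs → (∀ {x} → x ∈ xs → 0 < x) → 0 < lcmList xs
lcmList-pos []       _    = s≤s z≤n
lcmList-pos (x ∷ xs) pos = lcm-pos (pos (here refl)) (lcmList-pos xs (pos ∘ there))

∈-range⁺ : ∀ {k m n} → k ≤ m → m ≤ n → m ∈ range k n
∈-range⁺ {k} {m} k≤m m≤n = subst (_∈ range k _) (ℕP.m+[n∸m]≡n k≤m)
  (∈-map⁺ (k ℕ.+_) (∈-upTo⁺ (s≤s (ℕP.∸-monoˡ-≤ k m≤n))))

∈-range⁻ : ∀ {k m n} → k ≤ n → m ∈ range k n → m ≤ n
∈-range⁻ {k} {m} {n} k≤n m∈range with ∈-map⁻ (k ℕ.+_) m∈range
... | j , j∈upTo , refl = begin
  k ℕ.+ j          ≤⟨ ℕP.+-monoʳ-≤ k (ℕP.≤-pred (∈-upTo⁻ j∈upTo)) ⟩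
  k ℕ.+ (n ∸ k)    ≡⟨ ℕP.m+[n∸m]≡n k≤n ⟩
  n                ∎
  where open ℕP.≤-Reasoning

d∣lcmD : ∀ {n k m} → k ≤ m → m ≤ n → d m k ∣ lcmD n k
d∣lcmD {k = k} k≤m m≤n = ∈⇒∣lcmList (∈-map⁺ (λ m → d m k) (∈-range⁺ k≤m m≤n))

lcmD-least : ∀ {n k c} → k ≤ n → (∀ m → m ≤ n → d m k ∣ c) → lcmD n k ∣ c
lcmD-least {n} {k} {c} k≤n d∣c = lcmList-least (map (λ m → d m k) (range k n)) bound
  where
  bound : ∀ {x} → x ∈ map (λ m → d m k) (range k n) → x ∣ c
  bound x∈ds with ∈-map⁻ (λ m → d m k) {xs = range k n} x∈ds
  ... | m , m∈range , refl = d∣c m (∈-range⁻ k≤n m∈range)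

lcmD-pos : ∀ n k → 0 < lcmD n k
lcmD-pos n k = lcmList-pos (map (λ m → d m k) (range k n)) pos
  where
  pos : ∀ {x} → x ∈ map (λ m → d m k) (range k n) → 0 < x
  pos x∈ds with ∈-map⁻ (λ m → d m k) {xs = range k n} x∈ds
  ... | m , _ , refl = s≤s z≤n

*sumℚ-recipℕ-product-isInteger : ∀ c Ls → (∀ {is} → is ∈ Ls → product is ∣ c) →
                                 IsInteger (ℕtoℚ c * sumℚ (map (recipℕ ∘ product) Ls))
*sumℚ-recipℕ-product-isInteger c []        _    = + 0 , ℚP.*-zeroʳ (ℕtoℚ c)
*sumℚ-recipℕ-product-isInteger c (is ∷ Ls) all∣ =
  subst IsInteger (sym (ℚP.*-distribˡ-+ (ℕtoℚ c) (recipℕ (product is)) _))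
    (isInteger-+ (∣⇒isInteger-*recipℕ (all∣ (here refl)))
                 (*sumℚ-recipℕ-product-isInteger c Ls (all∣ ∘ there)))

q*F-isInteger : ∀ n k m → m ≤ n → IsInteger (ℕtoℚ (q n k) * F m k)
q*F-isInteger n k m m≤n = *sumℚ-recipℕ-product-isInteger (q n k) (comps m k) λ is∈comps →
  ∈⇒∣lcmList (∈-map⁺ product (∈-concat⁺′ is∈comps (∈-map⁺ (λ m → comps m k) (∈-upTo⁺ (s≤s m≤n)))))

theorem2 : (n k : ℕ) → k ≤ n → IsCnk n k (lcmD n k) × (lcmD n k ∣ q n k)
theorem2 n k k≤n = ((lcmD-pos n k , scale-derivN-∈E n k (lcmD n k) (λ m → d∣lcmD)) , minimal) , lcmD∣q
  where
  minimal : (c : ℕ) → GoodMultiplier n k c → lcmD n k ≤ c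
  minimal c good = ∣⇒≤ {{ℕ.>-nonZero (proj₁ good)}} (lcmD-least k≤n (good⇒d∣ n k c good))
  lcmD∣q : lcmD n k ∣ q n k
  lcmD∣q = lcmD-least k≤n (λ m m≤n → isInteger⇒↧ₙ∣ (q n k) (F m k) (q*F-isInteger n k m m≤n))
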